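{- Let $R$ be the ring of all $3\times 3$ matrices over $GF(2)$ of the form $$M(a,b,c,d)=\begin{pmatrix} a & c & d\\ 0 & b & 0\\ 0 & 0 & b\end{pmatrix},\qquad a,b,c,d\in GF(2),$$ and write $0=M(0,0,0,0)$, $3=M(0,0,1,0)$, $5=M(0,0,1,1)$, $6=M(0,0,0,1)$, $8=M(0,1,0,0)$, $11=M(0,1,1,0)$, $13=M(0,1,1,1)$, $14=M(0,1,0,1)$. Let $J=\{0,3,5,6\}$ and let $\mathcal{D}$ be the doily on the point set $J^2\setminus\{(0,0)\}$ defined in the context. Consider the nine submodules $$R(3,8),\ R(5,8),\ R(6,8),\ R(8,11),\ R(8,13),\ R(8,14),\ R(8,6),\ R(8,5),\ R(8,3)$$ of the free left module $R^2$; for each of them, its intersection with $J^2\setminus\{(0,0)\}$ is the union of three lines of $\mathcal{D}$ through a common point, called its point of concurrence. Then exactly six lines of $\mathcal{D}$ are each contained in three of these nine submodules; each of the nine points of concurrence lies on exactly two of these six lines; and the incidence structure formed by the nine points of concurrence and these six lines is isomorphic to the generalized quadrangle $GQ(2,1)$ (the $3\times 3$ grid).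
   Context: For $(x,y)\in R^2$, $R(x,y)=\{(\alpha x,\alpha y):\alpha\in R\}$. The doily $\mathcal{D}$ is defined via the duad–syntheme model: for $S=\{1,\dots,6\}$, a duad is a $2$-element subset of $S$ and a syntheme is a set of three pairwise disjoint duads. Identify duads with points of $J^2\setminus\{(0,0)\}$ via $\{1,2\}\leftrightarrow(3,3)$, $\{1,3\}\leftrightarrow(5,3)$, $\{1,4\}\leftrightarrow(0,6)$, $\{1,5\}\leftrightarrow(3,6)$, $\{1,6\}\leftrightarrow(5,0)$, $\{2,3\}\leftrightarrow(6,0)$, $\{2,4\}\leftrightarrow(3,5)$, $\{2,5\}\leftrightarrow(0,5)$, $\{2,6\}\leftrightarrow(6,3)$, $\{3,4\}\leftrightarrow(5,5)$, $\{3,5\}\leftrightarrow(6,5)$, $\{3,6\}\leftrightarrow(0,3)$, $\{4,5\}\leftrightarrow(3,0)$, $\{4,6\}\leftrightarrow(5,6)$, $\{5,6\}\leftrightarrow(6,6)$. The lines of $\mathcal{D}$ are the $15$ synthemes (a line is the set of the three points corresponding to the duads of a syntheme). $GQ(2,1)$ is the generalized quadrangle with $9$ points and $6$ lines, three points per line and two lines per point, i.e. the $3\times 3$ grid. -}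

module Defs where

open import Data.Bool using (Bool; true; false; _∧_; _xor_; T; not)
open import Data.Nat using (ℕ; _<ᵇ_)
open import Data.Fin using (Fin; zero; suc)
open import Data.Fin.Properties using () renaming (_≟_ to _≟ᶠ_)
open import Data.Product using (Σ; _×_; _,_; ∃)
open import Data.Sum using (_⊎_)
open import Relation.Nullary.Decidable using (⌊_⌋)
open import Relation.Binary.PropositionalEquality using (_≡_)

-- GF(2) = Bool with  + = xor,  · = ∧ ;  3×3 matrices over GF(2)

Mat3 : Set
Mat3 = Fin 3 → Fin 3 → Bool

_⊗_ : Mat3 → Mat3 → Mat3
(A ⊗ B) i j = ((A i zero ∧ B zero j) xor (A i (suc zero) ∧ B (suc zero) j))
              xor (A i (suc (suc zero)) ∧ B (suc (suc zero)) j)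

-- The ring R of matrices  M(a,b,c,d) = [[a,c,d],[0,b,0],[0,0,b]].
-- An element of R is recorded by its parameters (a,b,c,d).

record R : Set where
  constructor mk
  field
    a b c d : Bool

M : R → Mat3
M (mk a b c d) zero zero = a
M (mk a b c d) zero (suc zero) = c
M (mk a b c d) zero (suc (suc zero)) = d
M (mk a b c d) (suc zero) (suc zero) = b
M (mk a b c d) (suc (suc zero)) (suc (suc zero)) = b
M (mk a b c d) _ _ = false

fromMat : Mat3 → R
fromMat m = mk (m zero zero) (m (suc zero) (suc zero))
               (m zero (suc zero)) (m zero (suc (suc zero)))

-- multiplication in R is matrix multiplication (R is closed under it)
_·_ : R → R → R
x · y = fromMat (M x ⊗ M y)

infixl 7 _·_

r0 r3 r5 r6 r8 r11 r13 r14 : R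
r0  = mk false false false false
r3  = mk false false true  false
r5  = mk false false true  true
r6  = mk false false false true
r8  = mk false true  false false
r11 = mk false true  true  false
r13 = mk false true  true  true
r14 = mk false true  false true

R² : Set
R² = R × R

_∈R_ : R² → R² → Set
(p , q) ∈R (x , y) = Σ R λ α → (α · x ≡ p) × (α · y ≡ q)

-- Duads of S = {1,…,6}  (the 15 points of the doily)

data Duad : Set where
  d12 d13 d14 d15 d16 d23 d24 d25 d26 d34 d35 d36 d45 d46 d56 : Duad

s1 s2 s3 s4 s5 s6 : Fin 6
s1 = zero
s2 = suc zero
s3 = suc (suc zero)
s4 = suc (suc (suc zero))
s5 = suc (suc (suc (suc zero)))
s6 = suc (suc (suc (suc (suc zero))))

elems : Duad → Fin 6 × Fin 6
elems d12 = s1 , s2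
elems d13 = s1 , s3
elems d14 = s1 , s4
elems d15 = s1 , s5
elems d16 = s1 , s6
elems d23 = s2 , s3
elems d24 = s2 , s4
elems d25 = s2 , s5
elems d26 = s2 , s6
elems d34 = s3 , s4
elems d35 = s3 , s5
elems d36 = s3 , s6
elems d45 = s4 , s5
elems d46 = s4 , s6
elems d56 = s5 , s6

-- a fixed enumeration index (used only to store a syntheme canonically)
idx : Duad → ℕ
idx d12 = 0
idx d13 = 1
idx d14 = 2
idx d15 = 3
idx d16 = 4
idx d23 = 5
idx d24 = 6
idx d25 = 7
idx d26 = 8
idx d34 = 9
idx d35 = 10
idx d36 = 11
idx d45 = 12
idx d46 = 13
idx d56 = 14

_==_ : Fin 6 → Fin 6 → Bool
i == j = ⌊ i ≟ᶠ j ⌋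

disjoint : Duad → Duad → Bool
disjoint e f with elems e | elems f
... | (i , j) | (k , l) = not (i == k) ∧ not (i == l) ∧ not (j == k) ∧ not (j == l)

-- A syntheme: three pairwise disjoint duads (stored in increasing idx order,
-- so that each syntheme has exactly one representation).  These are the
-- 15 lines of the doily.
record Line : Set where
  constructor line
  field
    e₁ e₂ e₃ : Duad
    ordered  : T ((idx e₁ <ᵇ idx e₂) ∧ (idx e₂ <ᵇ idx e₃))
    disj     : T (disjoint e₁ e₂ ∧ disjoint e₁ e₃ ∧ disjoint e₂ e₃)

_∈L_ : Duad → Line → Set
p ∈L line e₁ e₂ e₃ _ _ = (p ≡ e₁) ⊎ (p ≡ e₂) ⊎ (p ≡ e₃)

-- the identification of duads with points of J² ∖ {(0,0)}, J = {0,3,5,6}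
pt : Duad → R²
pt d12 = r3 , r3
pt d13 = r5 , r3
pt d14 = r0 , r6
pt d15 = r3 , r6
pt d16 = r5 , r0
pt d23 = r6 , r0
pt d24 = r3 , r5
pt d25 = r0 , r5
pt d26 = r6 , r3
pt d34 = r5 , r5
pt d35 = r6 , r5
pt d36 = r0 , r3
pt d45 = r3 , r0
pt d46 = r5 , r6
pt d56 = r6 , r6

gen : Fin 9 → R²
gen zero = r3 , r8
gen (suc zero) = r5 , r8
gen (suc (suc zero)) = r6 , r8
gen (suc (suc (suc zero))) = r8 , r11
gen (suc (suc (suc (suc zero)))) = r8 , r13
gen (suc (suc (suc (suc (suc zero))))) = r8 , r14
gen (suc (suc (suc (suc (suc (suc zero)))))) = r8 , r6
gen (suc (suc (suc (suc (suc (suc (suc zero))))))) = r8 , r5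
gen (suc (suc (suc (suc (suc (suc (suc (suc zero)))))))) = r8 , r3

_⊆M_ : Line → Fin 9 → Set
L ⊆M i = ∀ p → p ∈L L → pt p ∈R gen i

ConcurrentAt : Fin 9 → Duad → Set
ConcurrentAt i c =
  Σ Line λ L₁ → Σ Line λ L₂ → Σ Line λ L₃ →
    (L₁ ≢ L₂) × (L₁ ≢ L₃) × (L₂ ≢ L₃) ×
    (c ∈L L₁) × (c ∈L L₂) × (c ∈L L₃) ×
    (∀ p → (pt p ∈R gen i) → (p ∈L L₁) ⊎ (p ∈L L₂) ⊎ (p ∈L L₃)) ×
    (∀ p → (p ∈L L₁) ⊎ (p ∈L L₂) ⊎ (p ∈L L₃) → pt p ∈R gen i)
  where
    open import Relation.Binary.PropositionalEquality using (_≢_)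

InExactlyThree : Line → Set
InExactlyThree L =
  Σ (Fin 9) λ i₁ → Σ (Fin 9) λ i₂ → Σ (Fin 9) λ i₃ →
    (i₁ ≢ i₂) × (i₁ ≢ i₃) × (i₂ ≢ i₃) ×
    (L ⊆M i₁) × (L ⊆M i₂) × (L ⊆M i₃) ×
    (∀ i → L ⊆M i → (i ≡ i₁) ⊎ (i ≡ i₂) ⊎ (i ≡ i₃))
  where
    open import Relation.Binary.PropositionalEquality using (_≢_)

GridPoint : Set
GridPoint = Fin 3 × Fin 3

GridLine : Set
GridLine = Fin 2 × Fin 3

GridInc : GridPoint → GridLine → Set
GridInc (r , s) (zero , k) = r ≡ k
GridInc (r , s) (suc _ , k) = s ≡ k

-- Everything about R and the doily is finite: R has sixteen elements, the doily fifteen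
-- points and fifteen lines, so every concrete incidence fact can be decided by exhaustive
-- search.  The search only has to establish two things: each of the nine submodules is the
-- union of the three doily lines through its point of concurrence, and the six lines shared
-- by two submodules meet the nine points of concurrence exactly as the rows and columns of a
-- 3×3 grid meet its cells.  The counting statements then follow from the combinatorics of
-- the grid alone.
module Submission where

open import Defs
open import Data.Bool using (Bool; true; false; T; T?; _∧_)
open import Data.Bool.Properties using (T-irrelevant)
open import Data.Fin using (Fin; zero; suc; #_)
import Data.Fin.Properties as Fin
open import Data.Nat using (_<ᵇ_)
open import Data.Product using (Σ; _×_; _,_; ∃; proj₁; proj₂)
open import Data.Sum using (_⊎_; inj₁; inj₂)
import Data.Sum
open import Data.Bool.Instances
open import Data.Fin.Instances
open import Data.Product.Instances
open import Function using (_∘_)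
open import Function.Bundles using (_⇔_; _⤖_; Bijection; Equivalence; mk⇔; mk↣; mk⤖)
open import Function.Consequences.Propositional using (strictlySurjective⇒surjective)
open import Function.Definitions using (Injective; StrictlySurjective)
open import Function.Properties.Inverse using (↔⇒⤖)
open import Level using (0ℓ)
open import Relation.Binary.PropositionalEquality using (_≡_; _≢_; refl; sym; trans; cong; cong₂; subst)
open import Relation.Binary.PropositionalEquality.Properties using (isDecEquivalence)
open import Relation.Binary.Structures using (IsDecEquivalence)
open import Relation.Binary.TypeClasses using (_≟_)
open import Relation.Nullary using (Dec)
open import Relation.Nullary.Decidable
  using (map′; ¬?; _×-dec_; _⊎-dec_; _→-dec_; from-yes; decidable-stable; via-injection)
open import Relation.Unary using (Pred; Decidable)

private
  variable
    A B : Set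

record Searchable (A : Set) : Set₁ where
  field
    any? : {P : Pred A 0ℓ} → Decidable P → Dec (∃ P)

open Searchable {{...}}

all? : {{Searchable A}} → {P : Pred A 0ℓ} → Decidable P → Dec (∀ x → P x)
all? P? = map′ (λ ¬∃¬ x → decidable-stable (P? x) (λ ¬p → ¬∃¬ (x , ¬p)))
               (λ ∀p (x , ¬p) → ¬p (∀p x))
               (¬? (any? (¬? ∘ P?)))

infixr 2 _⇔-dec_

_⇔-dec_ : Dec A → Dec B → Dec (A ⇔ B)
a? ⇔-dec b? = map′ (λ (f , g) → mk⇔ f g) (λ e → Equivalence.to e , Equivalence.from e)
                   ((a? →-dec b?) ×-dec (b? →-dec a?))

surjective⇒searchable : (f : A → B) → StrictlySurjective _≡_ f → Searchable A → Searchable B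
surjective⇒searchable f surj S = record
  { any? = λ {P} P? → map′ (λ (x , p) → f x , p)
                           (λ (y , p) → let (x , fx≡y) = surj y in x , subst P (sym fx≡y) p)
                           (Searchable.any? S (P? ∘ f)) }

instance
  Fin-searchable : ∀ {n} → Searchable (Fin n)
  Fin-searchable = record { any? = Fin.any? }

  Bool-searchable : Searchable Bool
  Bool-searchable = record { any? = λ P? → map′ witness cases (P? false ⊎-dec P? true) }
    where
    witness : ∀ {P : Pred Bool 0ℓ} → P false ⊎ P true → ∃ P
    witness (inj₁ p) = false , p
    witness (inj₂ p) = true , p
    cases : ∀ {P : Pred Bool 0ℓ} → ∃ P → P false ⊎ P true
    cases (false , p) = inj₁ p
    cases (true , p) = inj₂ p

  ×-searchable : {{Searchable A}} → {{Searchable B}} → Searchable (A × B)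
  ×-searchable = record
    { any? = λ P? → map′ (λ (x , y , p) → (x , y) , p) (λ ((x , y) , p) → x , y , p)
                         (any? λ x → any? λ y → P? (x , y)) }

R-tuple : R → Bool × Bool × Bool × Bool
R-tuple (mk a b c d) = a , b , c , d

R-tuple-injective : Injective _≡_ _≡_ R-tuple
R-tuple-injective refl = refl

duad : Fin 15 → Duad
duad zero = d12
duad (suc zero) = d13
duad (suc (suc zero)) = d14
duad (suc (suc (suc zero))) = d15
duad (suc (suc (suc (suc zero)))) = d16
duad (suc (suc (suc (suc (suc zero))))) = d23
duad (suc (suc (suc (suc (suc (suc zero)))))) = d24
duad (suc (suc (suc (suc (suc (suc (suc zero))))))) = d25
duad (suc (suc (suc (suc (suc (suc (suc (suc zero)))))))) = d26
duad (suc (suc (suc (suc (suc (suc (suc (suc (suc zero))))))))) = d34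
duad (suc (suc (suc (suc (suc (suc (suc (suc (suc (suc zero)))))))))) = d35
duad (suc (suc (suc (suc (suc (suc (suc (suc (suc (suc (suc zero))))))))))) = d36
duad (suc (suc (suc (suc (suc (suc (suc (suc (suc (suc (suc (suc zero)))))))))))) = d45
duad (suc (suc (suc (suc (suc (suc (suc (suc (suc (suc (suc (suc (suc zero))))))))))))) = d46
duad (suc (suc (suc (suc (suc (suc (suc (suc (suc (suc (suc (suc (suc (suc zero)))))))))))))) = d56

index : Duad → Fin 15
index d12 = # 0
index d13 = # 1
index d14 = # 2
index d15 = # 3
index d16 = # 4
index d23 = # 5
index d24 = # 6
index d25 = # 7
index d26 = # 8
index d34 = # 9
index d35 = # 10
index d36 = # 11
index d45 = # 12
index d46 = # 13
index d56 = # 14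

duad-index : ∀ d → duad (index d) ≡ d
duad-index d12 = refl
duad-index d13 = refl
duad-index d14 = refl
duad-index d15 = refl
duad-index d16 = refl
duad-index d23 = refl
duad-index d24 = refl
duad-index d25 = refl
duad-index d26 = refl
duad-index d34 = refl
duad-index d35 = refl
duad-index d36 = refl
duad-index d45 = refl
duad-index d46 = refl
duad-index d56 = refl

index-injective : Injective _≡_ _≡_ index
index-injective {d} {d′} e = trans (sym (duad-index d)) (trans (cong duad e) (duad-index d′))

triple : Line → Duad × Duad × Duad
triple L = Line.e₁ L , Line.e₂ L , Line.e₃ L

triple-injective : Injective _≡_ _≡_ triple
triple-injective {line _ _ _ o d} {line _ _ _ o′ d′} refl =
  cong₂ (line _ _ _) (T-irrelevant o o′) (T-irrelevant d d′)

instance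
  R-≡-isDecEquivalence : IsDecEquivalence {A = R} _≡_
  R-≡-isDecEquivalence = isDecEquivalence (via-injection (mk↣ R-tuple-injective) _≟_)

  Duad-≡-isDecEquivalence : IsDecEquivalence {A = Duad} _≡_
  Duad-≡-isDecEquivalence = isDecEquivalence (via-injection (mk↣ index-injective) _≟_)

  Line-≡-isDecEquivalence : IsDecEquivalence {A = Line} _≡_
  Line-≡-isDecEquivalence = isDecEquivalence (via-injection (mk↣ triple-injective) _≟_)

  R-searchable : Searchable R
  R-searchable = surjective⇒searchable (λ (a , b , c , d) → mk a b c d) (λ x → R-tuple x , refl) ×-searchable

  Duad-searchable : Searchable Duad
  Duad-searchable = surjective⇒searchable duad (λ d → index d , duad-index d) Fin-searchable

syntheme : Fin 15 → Line
syntheme zero = line d12 d34 d56 _ _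
syntheme (suc zero) = line d12 d35 d46 _ _
syntheme (suc (suc zero)) = line d12 d36 d45 _ _
syntheme (suc (suc (suc zero))) = line d13 d24 d56 _ _
syntheme (suc (suc (suc (suc zero)))) = line d13 d25 d46 _ _
syntheme (suc (suc (suc (suc (suc zero))))) = line d13 d26 d45 _ _
syntheme (suc (suc (suc (suc (suc (suc zero)))))) = line d14 d23 d56 _ _
syntheme (suc (suc (suc (suc (suc (suc (suc zero))))))) = line d14 d25 d36 _ _
syntheme (suc (suc (suc (suc (suc (suc (suc (suc zero)))))))) = line d14 d26 d35 _ _
syntheme (suc (suc (suc (suc (suc (suc (suc (suc (suc zero))))))))) = line d15 d23 d46 _ _
syntheme (suc (suc (suc (suc (suc (suc (suc (suc (suc (suc zero)))))))))) = line d15 d24 d36 _ _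
syntheme (suc (suc (suc (suc (suc (suc (suc (suc (suc (suc (suc zero))))))))))) = line d15 d26 d34 _ _
syntheme (suc (suc (suc (suc (suc (suc (suc (suc (suc (suc (suc (suc zero)))))))))))) = line d16 d23 d45 _ _
syntheme (suc (suc (suc (suc (suc (suc (suc (suc (suc (suc (suc (suc (suc zero))))))))))))) = line d16 d24 d35 _ _
syntheme (suc (suc (suc (suc (suc (suc (suc (suc (suc (suc (suc (suc (suc (suc zero)))))))))))))) = line d16 d25 d34 _ _

syntheme-surjective : StrictlySurjective _≡_ syntheme
syntheme-surjective (line e₁ e₂ e₃ o d) =
  let k , e = listed e₁ e₂ e₃ o d in k , triple-injective e
  where
  listed : ∀ e₁ e₂ e₃ → T ((idx e₁ <ᵇ idx e₂) ∧ (idx e₂ <ᵇ idx e₃)) →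
           T (disjoint e₁ e₂ ∧ disjoint e₁ e₃ ∧ disjoint e₂ e₃) →
           ∃ λ k → triple (syntheme k) ≡ (e₁ , e₂ , e₃)
  listed = from-yes (all? λ e₁ → all? λ e₂ → all? λ e₃ →
    T? ((idx e₁ <ᵇ idx e₂) ∧ (idx e₂ <ᵇ idx e₃)) →-dec
    T? (disjoint e₁ e₂ ∧ disjoint e₁ e₃ ∧ disjoint e₂ e₃) →-dec
    any? λ k → triple (syntheme k) ≟ (e₁ , e₂ , e₃))

instance
  Line-searchable : Searchable Line
  Line-searchable = surjective⇒searchable syntheme syntheme-surjective Fin-searchable

infix 4 _∈L?_ _∈R?_ _⊆M?_

_∈L?_ : ∀ p L → Dec (p ∈L L)
p ∈L? line e₁ e₂ e₃ _ _ = p ≟ e₁ ⊎-dec p ≟ e₂ ⊎-dec p ≟ e₃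

_∈R?_ : ∀ u g → Dec (u ∈R g)
(p , q) ∈R? (x , y) = any? λ α → α · x ≟ p ×-dec α · y ≟ q

_⊆M?_ : ∀ L i → Dec (L ⊆M i)
L ⊆M? i = all? λ p → p ∈L? L →-dec pt p ∈R? gen i

GridInc? : ∀ p l → Dec (GridInc p l)
GridInc? (r , s) (zero , k) = r ≟ k
GridInc? (r , s) (suc zero , k) = s ≟ k

row column : Fin 3 → GridLine
row r = zero , r
column s = suc zero , s

GridInc-row-or-column : ∀ {r s} l → GridInc (r , s) l → l ≡ row r ⊎ l ≡ column s
GridInc-row-or-column (zero , _) refl = inj₁ refl
GridInc-row-or-column (suc zero , _) refl = inj₂ refl

GridPoint-determined : ∀ {p q} → (∀ l → GridInc p l → GridInc q l) → p ≡ q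
GridPoint-determined {r , s} h = sym (cong₂ _,_ (h (row r) refl) (h (column s) refl))

GridLine-determined : ∀ {l m} → (∀ p → GridInc p l → GridInc p m) → l ≡ m
GridLine-determined {zero , k} {zero , _} h = cong row (h (k , zero) refl)
GridLine-determined {zero , k} {suc zero , _} h with h (k , zero) refl | h (k , suc zero) refl
... | refl | ()
GridLine-determined {suc zero , k} {zero , _} h with h (zero , k) refl | h (suc zero , k) refl
... | refl | ()
GridLine-determined {suc zero , k} {suc zero , _} h = cong column (h (zero , k) refl)

pointOn : GridLine → Fin 3 → GridPoint
pointOn (zero , r) s = r , s
pointOn (suc zero , s) r = r , s

pointOn-injective : ∀ l → Injective _≡_ _≡_ (pointOn l)
pointOn-injective (zero , _) refl = refl
pointOn-injective (suc zero , _) refl = refl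

pointOn-incident : ∀ l t → GridInc (pointOn l t) l
pointOn-incident (zero , _) _ = refl
pointOn-incident (suc zero , _) _ = refl

pointOn-complete : ∀ l p → GridInc p l → ∃ λ t → pointOn l t ≡ p
pointOn-complete (zero , _) (_ , s) refl = s , refl
pointOn-complete (suc zero , _) (r , _) refl = r , refl

∈-image-Fin3 : (f : Fin 3 → A) → ∀ {x} → (∃ λ t → f t ≡ x) →
               (x ≡ f zero) ⊎ (x ≡ f (suc zero)) ⊎ (x ≡ f (suc (suc zero)))
∈-image-Fin3 f (zero , refl) = inj₁ refl
∈-image-Fin3 f (suc zero , refl) = inj₂ (inj₁ refl)
∈-image-Fin3 f (suc (suc zero) , refl) = inj₂ (inj₂ refl)

row≢column : ∀ {r s} → row r ≢ column s
row≢column ()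

module GridIsomorphism {X Y : Set} (_∈_ : X → Y → Set) (c : Fin 9 → X) (ℓ : Fin 6 → Y)
  (φ : Fin 9 ⤖ GridPoint) (ψ : Fin 6 ⤖ GridLine)
  (incidence : ∀ i j → c i ∈ ℓ j ⇔ GridInc (Bijection.to φ i) (Bijection.to ψ j)) where

  private
    module φ = Bijection φ
    module ψ = Bijection ψ

    φ⁻ : GridPoint → Fin 9
    φ⁻ = proj₁ ∘ φ.strictlySurjective

    ψ⁻ : GridLine → Fin 6
    ψ⁻ = proj₁ ∘ ψ.strictlySurjective

    φ∘φ⁻ : ∀ p → φ.to (φ⁻ p) ≡ p
    φ∘φ⁻ = proj₂ ∘ φ.strictlySurjective

    ψ∘ψ⁻ : ∀ l → ψ.to (ψ⁻ l) ≡ l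
    ψ∘ψ⁻ = proj₂ ∘ ψ.strictlySurjective

    φ⁻∘φ : ∀ i → φ⁻ (φ.to i) ≡ i
    φ⁻∘φ i = φ.injective (φ∘φ⁻ (φ.to i))

    to-grid : ∀ {i j} → c i ∈ ℓ j → GridInc (φ.to i) (ψ.to j)
    to-grid = Equivalence.to (incidence _ _)

    from-grid : ∀ {i j} → GridInc (φ.to i) (ψ.to j) → c i ∈ ℓ j
    from-grid = Equivalence.from (incidence _ _)

  c-injective : Injective _≡_ _≡_ c
  c-injective {i} {i′} e = φ.injective (GridPoint-determined same-lines)
    where
    same-lines : ∀ l → GridInc (φ.to i) l → GridInc (φ.to i′) l
    same-lines l g with ψ.strictlySurjective l
    ... | j , refl = to-grid (subst (_∈ ℓ j) e (from-grid g))

  ℓ-injective : Injective _≡_ _≡_ ℓ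
  ℓ-injective {j} {j′} e = ψ.injective (GridLine-determined same-points)
    where
    same-points : ∀ p → GridInc p (ψ.to j) → GridInc p (ψ.to j′)
    same-points p g with φ.strictlySurjective p
    ... | i , refl = to-grid (subst (c i ∈_) e (from-grid g))

  on-exactly-two : ∀ i → Σ (Fin 6) λ j₁ → Σ (Fin 6) λ j₂ →
    (j₁ ≢ j₂) × (c i ∈ ℓ j₁) × (c i ∈ ℓ j₂) × (∀ j → c i ∈ ℓ j → (j ≡ j₁) ⊎ (j ≡ j₂))
  on-exactly-two i =
    ψ⁻ (row r) , ψ⁻ (column s) ,
    (λ e → row≢column (trans (sym (ψ∘ψ⁻ _)) (trans (cong ψ.to e) (ψ∘ψ⁻ _)))) ,
    from-grid (subst (GridInc (φ.to i)) (sym (ψ∘ψ⁻ _)) refl) ,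
    from-grid (subst (GridInc (φ.to i)) (sym (ψ∘ψ⁻ _)) refl) ,
    λ j m → Data.Sum.map (λ e → ψ.injective (trans e (sym (ψ∘ψ⁻ _))))
                         (λ e → ψ.injective (trans e (sym (ψ∘ψ⁻ _))))
                         (GridInc-row-or-column (ψ.to j) (to-grid m))
    where
    r = proj₁ (φ.to i)
    s = proj₂ (φ.to i)

  pointsOf : Fin 6 → Fin 3 → Fin 9
  pointsOf j t = φ⁻ (pointOn (ψ.to j) t)

  pointsOf-injective : ∀ j → Injective _≡_ _≡_ (pointsOf j)
  pointsOf-injective j e =
    pointOn-injective (ψ.to j) (trans (sym (φ∘φ⁻ _)) (trans (cong φ.to e) (φ∘φ⁻ _)))

  on⇔pointsOf : ∀ i j → c i ∈ ℓ j ⇔ ∃ λ t → pointsOf j t ≡ i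
  on⇔pointsOf i j = mk⇔ point-of on
    where
    point-of : c i ∈ ℓ j → ∃ λ t → pointsOf j t ≡ i
    point-of m = let t , e = pointOn-complete (ψ.to j) (φ.to i) (to-grid m)
                 in t , trans (cong φ⁻ e) (φ⁻∘φ i)
    on : ∃ (λ t → pointsOf j t ≡ i) → c i ∈ ℓ j
    on (t , refl) = from-grid (subst (λ p → GridInc p (ψ.to j)) (sym (φ∘φ⁻ _)) (pointOn-incident (ψ.to j) t))

concurrencePoint : Fin 9 → Duad
concurrencePoint zero = d36
concurrencePoint (suc zero) = d25
concurrencePoint (suc (suc zero)) = d14
concurrencePoint (suc (suc (suc zero))) = d12
concurrencePoint (suc (suc (suc (suc zero)))) = d34
concurrencePoint (suc (suc (suc (suc (suc zero))))) = d56
concurrencePoint (suc (suc (suc (suc (suc (suc zero)))))) = d23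
concurrencePoint (suc (suc (suc (suc (suc (suc (suc zero))))))) = d16
concurrencePoint (suc (suc (suc (suc (suc (suc (suc (suc zero)))))))) = d45

gridLine : Fin 6 → Line
gridLine zero = line d14 d25 d36 _ _
gridLine (suc zero) = line d12 d34 d56 _ _
gridLine (suc (suc zero)) = line d16 d23 d45 _ _
gridLine (suc (suc (suc zero))) = line d12 d36 d45 _ _
gridLine (suc (suc (suc (suc zero)))) = line d16 d25 d34 _ _
gridLine (suc (suc (suc (suc (suc zero))))) = line d14 d23 d56 _ _

gridPosition : Fin 9 → GridPoint
gridPosition zero = zero , zero
gridPosition (suc zero) = zero , suc zero
gridPosition (suc (suc zero)) = zero , suc (suc zero)
gridPosition (suc (suc (suc zero))) = suc zero , zero
gridPosition (suc (suc (suc (suc zero)))) = suc zero , suc zero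
gridPosition (suc (suc (suc (suc (suc zero))))) = suc zero , suc (suc zero)
gridPosition (suc (suc (suc (suc (suc (suc zero)))))) = suc (suc zero) , suc (suc zero)
gridPosition (suc (suc (suc (suc (suc (suc (suc zero))))))) = suc (suc zero) , suc zero
gridPosition (suc (suc (suc (suc (suc (suc (suc (suc zero)))))))) = suc (suc zero) , zero

gridPositions : Fin 9 ⤖ GridPoint
gridPositions = mk⤖ (injective , strictlySurjective⇒surjective surjective)
  where
  injective : Injective _≡_ _≡_ gridPosition
  injective {i} {i′} = from-yes (all? λ i → all? λ i′ → gridPosition i ≟ gridPosition i′ →-dec i ≟ i′) i i′
  surjective : StrictlySurjective _≡_ gridPosition
  surjective = from-yes (all? λ p → any? λ i → gridPosition i ≟ p)

gridLineIndices : Fin 6 ⤖ GridLine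
gridLineIndices = ↔⇒⤖ Fin.*↔×

concurrent : ∀ i → ConcurrentAt i (concurrencePoint i)
concurrent = from-yes (all? λ i → concurrentAt? i (concurrencePoint i))
  where
  -- Searched with the incidences to c first, so that only lines through c are ever combined.
  concurrentAt? : ∀ i c → Dec (ConcurrentAt i c)
  concurrentAt? i c = map′
    (λ (L₁ , c∈L₁ , L₂ , c∈L₂ , L₁≢L₂ , L₃ , c∈L₃ , L₁≢L₃ , L₂≢L₃ , ⊆∪ , ∪⊆) →
       L₁ , L₂ , L₃ , L₁≢L₂ , L₁≢L₃ , L₂≢L₃ , c∈L₁ , c∈L₂ , c∈L₃ , ⊆∪ , ∪⊆)
    (λ (L₁ , L₂ , L₃ , L₁≢L₂ , L₁≢L₃ , L₂≢L₃ , c∈L₁ , c∈L₂ , c∈L₃ , ⊆∪ , ∪⊆) →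
       L₁ , c∈L₁ , L₂ , c∈L₂ , L₁≢L₂ , L₃ , c∈L₃ , L₁≢L₃ , L₂≢L₃ , ⊆∪ , ∪⊆)
    (any? λ L₁ → c ∈L? L₁ ×-dec any? λ L₂ → c ∈L? L₂ ×-dec ¬? (L₁ ≟ L₂) ×-dec
     any? λ L₃ → c ∈L? L₃ ×-dec ¬? (L₁ ≟ L₃) ×-dec ¬? (L₂ ≟ L₃) ×-dec
     all? (λ p → pt p ∈R? gen i →-dec (p ∈L? L₁ ⊎-dec p ∈L? L₂ ⊎-dec p ∈L? L₃)) ×-dec
     all? (λ p → (p ∈L? L₁ ⊎-dec p ∈L? L₂ ⊎-dec p ∈L? L₃) →-dec pt p ∈R? gen i))

incidence : ∀ i j → concurrencePoint i ∈L gridLine j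
                    ⇔ GridInc (Bijection.to gridPositions i) (Bijection.to gridLineIndices j)
incidence = from-yes (all? λ i → all? λ j →
  concurrencePoint i ∈L? gridLine j ⇔-dec GridInc? (gridPosition i) (Bijection.to gridLineIndices j))

gridLine⊆M⇔concurrencePoint∈L : ∀ i j → gridLine j ⊆M i ⇔ concurrencePoint i ∈L gridLine j
gridLine⊆M⇔concurrencePoint∈L = from-yes (all? λ i → all? λ j →
  gridLine j ⊆M? i ⇔-dec concurrencePoint i ∈L? gridLine j)

shared-isGridLine : ∀ L i₁ i₂ → i₁ ≢ i₂ → L ⊆M i₁ → L ⊆M i₂ → ∃ λ j → gridLine j ≡ L
shared-isGridLine L i₁ i₂ i₁≢i₂ L⊆i₁ = shared L i₁ L⊆i₁ i₂ i₁≢i₂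
  where
  -- Quantified in this order so that L ⊆M i₁ is decided once, not once for every i₂.
  shared : ∀ L i₁ → L ⊆M i₁ → ∀ i₂ → i₁ ≢ i₂ → L ⊆M i₂ → ∃ λ j → gridLine j ≡ L
  shared = from-yes (all? λ L → all? λ i₁ → L ⊆M? i₁ →-dec all? λ i₂ →
    ¬? (i₁ ≟ i₂) →-dec L ⊆M? i₂ →-dec any? λ j → gridLine j ≟ L)

open GridIsomorphism _∈L_ concurrencePoint gridLine gridPositions gridLineIndices incidence

gridLine-inExactlyThree : ∀ j → InExactlyThree (gridLine j)
gridLine-inExactlyThree j =
  point zero , point (suc zero) , point (suc (suc zero)) ,
  distinct {zero} {suc zero} (λ ()) , distinct {zero} {suc (suc zero)} (λ ()) ,
  distinct {suc zero} {suc (suc zero)} (λ ()) ,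
  contained zero , contained (suc zero) , contained (suc (suc zero)) , only
  where
  point : Fin 3 → Fin 9
  point = pointsOf j

  distinct : ∀ {t t′} → t ≢ t′ → point t ≢ point t′
  distinct t≢t′ = t≢t′ ∘ pointsOf-injective j

  contained : ∀ t → gridLine j ⊆M point t
  contained t = Equivalence.from (gridLine⊆M⇔concurrencePoint∈L (point t) j)
                                 (Equivalence.from (on⇔pointsOf (point t) j) (t , refl))

  only : ∀ i → gridLine j ⊆M i → (i ≡ point zero) ⊎ (i ≡ point (suc zero)) ⊎ (i ≡ point (suc (suc zero)))
  only i = ∈-image-Fin3 point ∘ Equivalence.to (on⇔pointsOf i j)
                              ∘ Equivalence.to (gridLine⊆M⇔concurrencePoint∈L i j)

isGridLine⇔inExactlyThree : ∀ L → (∃ λ j → gridLine j ≡ L) ⇔ InExactlyThree L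
isGridLine⇔inExactlyThree L = mk⇔ (λ { (j , refl) → gridLine-inExactlyThree j })
  λ (i₁ , i₂ , _ , i₁≢i₂ , _ , _ , L⊆i₁ , L⊆i₂ , _) → shared-isGridLine L i₁ i₂ i₁≢i₂ L⊆i₁ L⊆i₂

mainTheorem3 :
    Σ (Fin 9 → Duad) λ c →
      -- c i is the point of concurrence of the i-th submodule
      (∀ i → ConcurrentAt i (c i)) ×
      -- the nine points of concurrence are distinct
      Injective _≡_ _≡_ c ×
      Σ (Fin 6 → Line) λ ℓ →
        -- exactly six lines (ℓ 0 … ℓ 5) lie in exactly three of the submodules
        Injective _≡_ _≡_ ℓ ×
        (∀ L → (∃ λ j → ℓ j ≡ L) ⇔ InExactlyThree L) ×
        -- each point of concurrence lies on exactly two of these six lines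
        (∀ i → Σ (Fin 6) λ j₁ → Σ (Fin 6) λ j₂ →
           (j₁ ≢ j₂) × (c i ∈L ℓ j₁) × (c i ∈L ℓ j₂) ×
           (∀ j → c i ∈L ℓ j → (j ≡ j₁) ⊎ (j ≡ j₂))) ×
        -- (points of concurrence, six lines) ≅ GQ(2,1), the 3×3 grid
        (Σ (Fin 9 ⤖ GridPoint) λ φ → Σ (Fin 6 ⤖ GridLine) λ ψ →
           ∀ i j → (c i ∈L ℓ j) ⇔ GridInc (Bijection.to φ i) (Bijection.to ψ j))
mainTheorem3 =
  concurrencePoint , concurrent , c-injective ,
  gridLine , ℓ-injective , isGridLine⇔inExactlyThree , on-exactly-two ,
  gridPositions , gridLineIndices , incidence
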